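{- Let $L\subseteq \mathbf{Z}_2^n$ be a linear binary code of dimension $k$ such that the edge-colored graph $A=I^n_c/L$ is an adinkraizable chromotopology. Then the number of even dashings of $A$ and the number of odd dashings of $A$ are both equal to \[ |e(A)| = |o(A)| = 2^{2^{n-k}+k-1}. \]
   Context: A (linear binary) code is a $\mathbf{Z}_2$-subspace $L\subseteq\mathbf{Z}_2^n$; it is an $(n,k)$-code if $\dim L=k$. Let $e_i\in\mathbf{Z}_2^n$ be the $i$-th standard basis vector. The quotient $I^n_c/L$ is the edge-colored multigraph whose vertex set is $\mathbf{Z}_2^n/L$ and which has, for each coset $C$ and each color $i\in[n]=\{1,\dots,n\}$, an edge of color $i$ joining $C$ and $C+e_i$ (one edge of color $i$ per such unordered pair; it is a loop if $e_i\in L$). For a vertex $v$ let $q_i(v)$ be the other endpoint of the color-$i$ edge at $v$. A chromotopology of dimension $n$ is a finite connected simple bipartite graph in which every vertex has degree $n$, with edges colored by $[n]$ so that every vertex is incident to exactly one edge of each color, and such that for any distinct colors $i,j$ the edges of colors $i$ and $j$ form a disjoint union of $4$-cycles (these are the $2$-colored $4$-cycles). A dashing is a map $d\colon E(A)\to\mathbf{Z}_2$; it is odd (resp. even) if the sum of $d$ over the edges of every $2$-colored $4$-cycle is $1$ (resp. $0$). $o(A)$ and $e(A)$ denote the sets of odd and even dashings. A ranking of $A$ is a function $h\colon V(A)\to\mathbf{Z}$ with $|h(u)-h(w)|=1$ for every edge $\{u,w\}$ (this makes $A$ the Hasse diagram of a ranked poset). $A$ is adinkraizable if it admits both an odd dashing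 and a ranking. -}

module Defs where

open import Data.Nat using (ℕ; zero; suc; _+_; _∸_; _^_)
open import Data.Bool using (Bool; true; false; _xor_; if_then_else_)
open import Data.Fin using (Fin; zero; suc; _≟_)
open import Data.Vec using (Vec; zipWith; replicate; tabulate)
open import Data.Integer using (ℤ; _-_; ∣_∣)
open import Data.Product using (Σ; _×_; _,_; proj₁; ∃)
open import Data.Sum using (_⊎_)
open import Relation.Nullary using (¬_; does)
open import Relation.Binary using (Setoid; IsEquivalence)
open import Relation.Binary.PropositionalEquality using (_≡_; _≢_; refl; sym; trans)

Z2 : ℕ → Set
Z2 n = Vec Bool n

_⊕_ : ∀ {n} → Z2 n → Z2 n → Z2 n
_⊕_ = zipWith _xor_
infixl 6 _⊕_

zeroVec : ∀ {n} → Z2 n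
zeroVec = replicate _ false

e : ∀ {n} → Fin n → Z2 n
e i = tabulate (λ j → does (i ≟ j))

comb : ∀ {n k} → (Fin k → Bool) → (Fin k → Z2 n) → Z2 n
comb {k = zero}  c g = zeroVec
comb {k = suc k} c g =
  (if c zero then g zero else zeroVec) ⊕ comb (λ t → c (suc t)) (λ t → g (suc t))

-- g is linearly independent; then L = span g is an (n,k)-code
Independent : ∀ {n k} → (Fin k → Z2 n) → Set
Independent g = ∀ c → comb c g ≡ zeroVec → ∀ t → c t ≡ false

module Quotient {n k : ℕ} (g : Fin k → Z2 n) where

  InL : Z2 n → Set
  InL v = ∃ λ c → v ≡ comb c g

  -- x and y define the same vertex (coset) of I^n_c / L
  _~_ : Z2 n → Z2 n → Set
  x ~ y = InL (x ⊕ y)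

  -- the colour-i edge at x joins [x] and [x + e_i];
  -- the colour-i edge at x and the colour-j edge at y have the same endpoint pair
  SameEnds : Fin n → Fin n → Z2 n → Z2 n → Set
  SameEnds i j x y =
    (x ~ y × (x ⊕ e i) ~ (y ⊕ e j)) ⊎ (x ~ (y ⊕ e j) × (x ⊕ e i) ~ y)

  data Walk : Z2 n → Z2 n → Set where
    here : ∀ {x y} → x ~ y → Walk x y
    step : ∀ {x y} (i : Fin n) → Walk (x ⊕ e i) y → Walk x y

  Connected : Set
  Connected = ∀ x y → Walk x y

  NoLoops : Set
  NoLoops = ∀ i x → ¬ (x ~ (x ⊕ e i))

  -- distinct edges never join the same pair of vertices
  -- (edges of the same colour with the same endpoints are the same edge)
  NoMultiEdges : Set
  NoMultiEdges = ∀ i j x y → SameEnds i j x y → i ≡ j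

  Bipartite : Set
  Bipartite = Σ (Z2 n → Bool) λ col →
    (∀ x y → x ~ y → col x ≡ col y) × (∀ i x → col x ≢ col (x ⊕ e i))

  -- the i,j-coloured component through [x] is the closed walk
  -- x, x+e_i, x+e_i+e_j, x+e_j; it is a 4-cycle iff these are pairwise distinct
  TwoColouredFourCycles : Set
  TwoColouredFourCycles = ∀ i j → i ≢ j → ∀ x →
    let a = x ; b = x ⊕ e i ; c = x ⊕ e i ⊕ e j ; d = x ⊕ e j in
    ¬ (a ~ b) × ¬ (a ~ c) × ¬ (a ~ d) × ¬ (b ~ c) × ¬ (b ~ d) × ¬ (c ~ d)

  -- (finite; n-regular with exactly one edge of each colour at each vertex
  --  holds by construction of I^n_c / L)
  Chromotopology : Set
  Chromotopology =
    Connected × NoLoops × NoMultiEdges × Bipartite × TwoColouredFourCycles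

  -- a dashing: a Z₂-valued function on edges; edge (i,[x]) is given by (i, x)
  IsDashing : (Fin n → Z2 n → Bool) → Set
  IsDashing d = ∀ i x y → SameEnds i i x y → d i x ≡ d i y

  cycleSum : (Fin n → Z2 n → Bool) → Fin n → Fin n → Z2 n → Bool
  cycleSum d i j x = d i x xor d j (x ⊕ e i) xor d i (x ⊕ e j) xor d j x

  Odd : (Fin n → Z2 n → Bool) → Set
  Odd d = ∀ i j → i ≢ j → ∀ x → cycleSum d i j x ≡ true

  Even : (Fin n → Z2 n → Bool) → Set
  Even d = ∀ i j → i ≢ j → ∀ x → cycleSum d i j x ≡ false

  Ranking : (Z2 n → ℤ) → Set
  Ranking h = (∀ x y → x ~ y → h x ≡ h y) × (∀ i x → ∣ h x - h (x ⊕ e i) ∣ ≡ 1)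

  Adinkraizable : Set
  Adinkraizable =
    (Σ (Fin n → Z2 n → Bool) λ d → IsDashing d × Odd d) × (Σ (Z2 n → ℤ) Ranking)

  dashingSetoid : ((Fin n → Z2 n → Bool) → Set) → Setoid _ _
  dashingSetoid P = record
    { Carrier = Σ (Fin n → Z2 n → Bool) λ d → IsDashing d × P d
    ; _≈_ = λ d d' → ∀ i x → proj₁ d i x ≡ proj₁ d' i x
    ; isEquivalence = record
      { refl = λ i x → refl
      ; sym = λ p i x → sym (p i x)
      ; trans = λ p q i x → trans (p i x) (q i x) } }

  EvenDashings : Setoid _ _
  EvenDashings = dashingSetoid Even

  OddDashings : Setoid _ _
  OddDashings = dashingSetoid Odd

-- Even dashings of the cube I^n_c are exactly the coboundaries δf, δf i x = f x + f (x + e_i), of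
-- potentials f : Z₂ⁿ → Z₂, and f is unique once f 0 = 0. Such a dashing descends to I^n_c/L precisely
-- when f (x + l) = f x + f l for all l ∈ L. After extending a basis of L by h₁, …, h_{n−k} to a basis
-- of Z₂ⁿ, these potentials correspond to a linear form on L (k bits) together with an arbitrary
-- function on span h vanishing at 0 (2^{n−k} − 1 bits). Adding a fixed odd dashing exchanges even
-- and odd dashings.
module Submission where

open import Defs
open import Level using (0ℓ)
open import Data.Nat using (ℕ; zero; suc; _+_; _∸_; _^_)
open import Data.Nat.Properties using (+-suc; +-identityʳ; +-comm; m+n∸m≡n)
open import Data.Bool using (Bool; true; false; not; _∧_; _xor_; if_then_else_) renaming (_≟_ to _≟ᵇ_)
open import Data.Bool.Properties
  using ( xor-assoc; xor-comm; xor-identityˡ; xor-identityʳ; xor-same; true-xor; xor-∧-commutativeRing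
        ; ∧-distribˡ-xor; ∧-distribʳ-xor; ∧-identityʳ; ¬-not)
open import Data.Fin using (Fin; zero; suc; _≟_; punchIn)
open import Data.Fin.Properties using (any?; suc-injective; 2↔Bool; *↔×)
open import Data.Vec using (Vec; []; _∷_; _++_; take; drop; tabulate; lookup)
open import Data.Vec.Properties
  using ( zipWith-assoc; zipWith-comm; zipWith-identityˡ; zipWith-identityʳ; zipWith-inverseˡ
        ; map-id; tabulate-cong; tabulate∘lookup; lookup∘tabulate; lookup-replicate
        ; ++-injective; take++drop≡id)
import Data.Vec.Functional as Vector
open import Data.Vec.Functional.Properties using (insertAt-lookup; insertAt-punchIn)
open import Data.Product using (Σ; ∃; ∃₂; _×_; _,_; proj₁; proj₂)
open import Data.Product.Function.NonDependent.Propositional using (_×-↔_)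
open import Data.Sum using (inj₁; inj₂)
open import Function using (_∘_)
open import Function.Bundles using (Inverse; _↔_; mk↔ₛ′)
open import Function.Properties.Inverse using (↔-trans)
import Function.Construct.Composition as Composition
open import Algebra.Bundles using (CommutativeMonoid; CommutativeRing)
open import Algebra.Structures using (IsCommutativeMonoid)
import Algebra.Solver.CommutativeMonoid as CommutativeMonoidSolver
open import Relation.Nullary using (yes; no; does)
open import Relation.Binary using (Setoid)
import Relation.Binary.Construct.On as On
open import Function.Definitions using (Congruent; StrictlyInverseˡ; StrictlyInverseʳ)
open import Relation.Binary.PropositionalEquality

strictInverse : ∀ {S T : Setoid 0ℓ 0ℓ}
  (to : Setoid.Carrier S → Setoid.Carrier T) (from : Setoid.Carrier T → Setoid.Carrier S) →
  Congruent (Setoid._≈_ S) (Setoid._≈_ T) to → Congruent (Setoid._≈_ T) (Setoid._≈_ S) from →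
  StrictlyInverseˡ (Setoid._≈_ T) to from → StrictlyInverseʳ (Setoid._≈_ S) to from → Inverse S T
strictInverse {S} {T} to from to-cong from-cong to∘from from∘to = record
  { to = to ; from = from ; to-cong = to-cong ; from-cong = from-cong
  ; inverse = strictlyInverseˡ⇒inverseˡ to-cong to∘from , strictlyInverseʳ⇒inverseʳ from-cong from∘to }
  where open import Function.Consequences.Setoid S T

module ExponentTwo {A : Set} {_∙_ : A → A → A} {ε : A}
  (isCommutativeMonoid : IsCommutativeMonoid _≡_ _∙_ ε)
  (self-inverse : ∀ x → x ∙ x ≡ ε) where

  open IsCommutativeMonoid isCommutativeMonoid public using (assoc; comm; identityˡ; identityʳ)

  commutativeMonoid : CommutativeMonoid 0ℓ 0ℓ
  commutativeMonoid = record { isCommutativeMonoid = isCommutativeMonoid }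

  module Solver = CommutativeMonoidSolver commutativeMonoid
  open Solver using (solve; _⊜_) renaming (_⊕_ to _⊞_)

  cancelˡ : ∀ x y → x ∙ (x ∙ y) ≡ y
  cancelˡ x y = begin
    x ∙ (x ∙ y)  ≡⟨ assoc x x y ⟨
    (x ∙ x) ∙ y  ≡⟨ cong (_∙ y) (self-inverse x) ⟩
    ε ∙ y        ≡⟨ identityˡ y ⟩
    y            ∎
    where open ≡-Reasoning

  cancelʳ : ∀ x y → (y ∙ x) ∙ x ≡ y
  cancelʳ x y = trans (comm (y ∙ x) x) (trans (cong (x ∙_) (comm y x)) (cancelˡ x y))

  ∙≡ε⇒≡ : ∀ {x y} → x ∙ y ≡ ε → x ≡ y
  ∙≡ε⇒≡ {x} {y} eq = trans (sym (cancelʳ y x)) (trans (cong (_∙ y) eq) (identityˡ y))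

  ∙-interchange : ∀ w x y z → (w ∙ x) ∙ (y ∙ z) ≡ (w ∙ y) ∙ (x ∙ z)
  ∙-interchange = solve 4 (λ w x y z → (w ⊞ x) ⊞ (y ⊞ z) ⊜ (w ⊞ y) ⊞ (x ⊞ z)) refl

  ∙-swapʳ : ∀ x y z → (x ∙ y) ∙ z ≡ (x ∙ z) ∙ y
  ∙-swapʳ = solve 3 (λ x y z → (x ⊞ y) ⊞ z ⊜ (x ⊞ z) ⊞ y) refl

  cancel-common : ∀ a b c → (a ∙ c) ∙ (b ∙ c) ≡ a ∙ b
  cancel-common a b c = begin
    (a ∙ c) ∙ (b ∙ c)  ≡⟨ ∙-interchange a c b c ⟩
    (a ∙ b) ∙ (c ∙ c)  ≡⟨ cong ((a ∙ b) ∙_) (self-inverse c) ⟩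
    (a ∙ b) ∙ ε        ≡⟨ identityʳ (a ∙ b) ⟩
    a ∙ b ∎
    where open ≡-Reasoning

  square-cancel : ∀ a b c d → (a ∙ b) ∙ ((b ∙ c) ∙ ((d ∙ c) ∙ (a ∙ d))) ≡ ε
  square-cancel a b c d = begin
    (a ∙ b) ∙ ((b ∙ c) ∙ ((d ∙ c) ∙ (a ∙ d)))
      ≡⟨ solve 4 (λ a b c d → (a ⊞ b) ⊞ ((b ⊞ c) ⊞ ((d ⊞ c) ⊞ (a ⊞ d))) ⊜
                              ((a ⊞ a) ⊞ (b ⊞ b)) ⊞ ((c ⊞ c) ⊞ (d ⊞ d))) refl a b c d ⟩
    ((a ∙ a) ∙ (b ∙ b)) ∙ ((c ∙ c) ∙ (d ∙ d))
      ≡⟨ cong₂ _∙_ (cong₂ _∙_ (self-inverse a) (self-inverse b))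
                   (cong₂ _∙_ (self-inverse c) (self-inverse d)) ⟩
    (ε ∙ ε) ∙ (ε ∙ ε)  ≡⟨ trans (cong₂ _∙_ (identityˡ ε) (identityˡ ε)) (identityˡ ε) ⟩
    ε ∎
    where open ≡-Reasoning

module Xor = ExponentTwo (CommutativeRing.+-isCommutativeMonoid xor-∧-commutativeRing) xor-same

⊕-isCommutativeMonoid : ∀ {n} → IsCommutativeMonoid _≡_ (_⊕_ {n}) zeroVec
⊕-isCommutativeMonoid = record
  { isMonoid = record
    { isSemigroup = record
      { isMagma = record { isEquivalence = isEquivalence ; ∙-cong = cong₂ _⊕_ }
      ; assoc = zipWith-assoc xor-assoc }
    ; identity = zipWith-identityˡ xor-identityˡ , zipWith-identityʳ xor-identityʳ }
  ; comm = zipWith-comm xor-comm }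

⊕-self : ∀ {n} (x : Z2 n) → x ⊕ x ≡ zeroVec
⊕-self x = trans (cong (_⊕ x) (sym (map-id x))) (zipWith-inverseˡ xor-same x)

module Z2 {n : ℕ} = ExponentTwo (⊕-isCommutativeMonoid {n}) ⊕-self

tabulate-false : ∀ {n} → tabulate (λ (_ : Fin n) → false) ≡ zeroVec
tabulate-false {zero} = refl
tabulate-false {suc n} = cong (false ∷_) tabulate-false

∷⊕e-zero : ∀ {n} b (y : Z2 n) → (b ∷ y) ⊕ e zero ≡ not b ∷ y
∷⊕e-zero b y = cong₂ _∷_ (trans (xor-comm b true) (true-xor b))
  (trans (cong (y ⊕_) tabulate-false) (Z2.identityʳ y))

∷⊕e-suc : ∀ {n} b (y : Z2 n) j → (b ∷ y) ⊕ e (suc j) ≡ b ∷ (y ⊕ e j)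
∷⊕e-suc b y j = cong (_∷ y ⊕ e j) (xor-identityʳ b)

infixr 7 _·_
_·_ : ∀ {n} → Bool → Z2 n → Z2 n
b · v = if b then v else zeroVec

xor-· : ∀ {n} a b (v : Z2 n) → (a xor b) · v ≡ a · v ⊕ b · v
xor-· true  true  v = sym (⊕-self v)
xor-· true  false v = sym (Z2.identityʳ v)
xor-· false b     v = sym (Z2.identityˡ (b · v))

·-⊕ : ∀ {n} b (u w : Z2 n) → b · (u ⊕ w) ≡ b · u ⊕ b · w
·-⊕ true  u w = refl
·-⊕ false u w = sym (Z2.identityˡ zeroVec)

module _ {n : ℕ} where

  comb-false : ∀ {k} (v : Fin k → Z2 n) → comb (λ _ → false) v ≡ zeroVec
  comb-false {zero}  v = refl
  comb-false {suc k} v = trans (Z2.identityˡ _) (comb-false (v ∘ suc))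

  comb-cong : ∀ {k} {a a' : Fin k → Bool} (v : Fin k → Z2 n) → (∀ t → a t ≡ a' t) →
    comb a v ≡ comb a' v
  comb-cong {zero}  v eq = refl
  comb-cong {suc k} v eq = cong₂ _⊕_ (cong (_· v zero) (eq zero)) (comb-cong (v ∘ suc) (eq ∘ suc))

  comb-xor : ∀ {k} (a a' : Fin k → Bool) (v : Fin k → Z2 n) →
    comb (λ t → a t xor a' t) v ≡ comb a v ⊕ comb a' v
  comb-xor {zero}  a a' v = sym (Z2.identityˡ zeroVec)
  comb-xor {suc k} a a' v = begin
    (a zero xor a' zero) · v zero ⊕ comb (λ t → a (suc t) xor a' (suc t)) (v ∘ suc)
      ≡⟨ cong₂ _⊕_ (xor-· (a zero) (a' zero) (v zero)) (comb-xor (a ∘ suc) (a' ∘ suc) (v ∘ suc)) ⟩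
    (a zero · v zero ⊕ a' zero · v zero) ⊕ (comb (a ∘ suc) (v ∘ suc) ⊕ comb (a' ∘ suc) (v ∘ suc))
      ≡⟨ Z2.∙-interchange _ _ _ _ ⟩
    comb a v ⊕ comb a' v ∎
    where open ≡-Reasoning

  comb-∧ : ∀ {k} b (a : Fin k → Bool) (v : Fin k → Z2 n) → comb (λ t → b ∧ a t) v ≡ b · comb a v
  comb-∧ true  a v = refl
  comb-∧ false a v = comb-false v

  comb-removeAt : ∀ {m} (c : Fin (suc m) → Bool) (v : Fin (suc m) → Z2 n) p → c p ≡ false →
    comb c v ≡ comb (Vector.removeAt c p) (Vector.removeAt v p)
  comb-removeAt c v zero cp rewrite cp = Z2.identityˡ _
  comb-removeAt {suc m} c v (suc p) cp =
    cong (c zero · v zero ⊕_) (comb-removeAt (c ∘ suc) (v ∘ suc) p cp)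

  comb-unit : ∀ {k} (s : Fin k) (v : Fin k → Z2 n) → comb (λ t → does (s ≟ t)) v ≡ v s
  comb-unit zero    v = trans (cong (v zero ⊕_) (comb-false (v ∘ suc))) (Z2.identityʳ (v zero))
  comb-unit (suc s) v = trans (Z2.identityˡ _) (comb-unit s (v ∘ suc))

comb-false∷ : ∀ {n k} (c : Fin k → Bool) (v : Fin k → Z2 n) →
  comb c (λ t → false ∷ v t) ≡ false ∷ comb c v
comb-false∷ {k = zero}  c v = refl
comb-false∷ {k = suc k} c v rewrite comb-false∷ (c ∘ suc) (v ∘ suc) with c zero
... | true  = refl
... | false = refl

comb-e : ∀ {n} (r : Fin n → Bool) → comb r e ≡ tabulate r
comb-e {zero}  r = refl
comb-e {suc n} r rewrite comb-false∷ (r ∘ suc) e | comb-e (r ∘ suc) with r zero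
... | true  = cong (true ∷_) (trans (cong (_⊕ tabulate (r ∘ suc)) tabulate-false) (Z2.identityˡ _))
... | false = cong (false ∷_) (Z2.identityˡ _)

dot : ∀ {k} → (Fin k → Bool) → (Fin k → Bool) → Bool
dot {zero}  a c = false
dot {suc k} a c = (a zero ∧ c zero) xor dot (a ∘ suc) (c ∘ suc)

dot-cong : ∀ {k} {a a' c c' : Fin k → Bool} → (∀ t → a t ≡ a' t) → (∀ t → c t ≡ c' t) →
  dot a c ≡ dot a' c'
dot-cong {zero}  _   _   = refl
dot-cong {suc k} a≗a' c≗c' =
  cong₂ _xor_ (cong₂ _∧_ (a≗a' zero) (c≗c' zero)) (dot-cong (a≗a' ∘ suc) (c≗c' ∘ suc))

dot-falseˡ : ∀ {k} (c : Fin k → Bool) → dot (λ _ → false) c ≡ false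
dot-falseˡ {zero}  c = refl
dot-falseˡ {suc k} c = dot-falseˡ (c ∘ suc)

dot-xorˡ : ∀ {k} (a a' c : Fin k → Bool) → dot (λ t → a t xor a' t) c ≡ dot a c xor dot a' c
dot-xorˡ {zero}  a a' c = refl
dot-xorˡ {suc k} a a' c =
  trans (cong₂ _xor_ (∧-distribʳ-xor (c zero) (a zero) (a' zero)) (dot-xorˡ (a ∘ suc) (a' ∘ suc) (c ∘ suc)))
        (Xor.∙-interchange (a zero ∧ c zero) (a' zero ∧ c zero) (dot (a ∘ suc) (c ∘ suc)) (dot (a' ∘ suc) (c ∘ suc)))

dot-unitˡ : ∀ {k} (s : Fin k) (c : Fin k → Bool) → dot (λ t → does (s ≟ t)) c ≡ c s
dot-unitˡ zero    c = trans (cong (c zero xor_) (dot-falseˡ (c ∘ suc))) (xor-identityʳ (c zero))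
dot-unitˡ (suc s) c = dot-unitˡ s (c ∘ suc)

record JointBasis {n k m : ℕ} (g : Fin k → Z2 n) (h : Fin m → Z2 n) : Set where
  field
    decompose   : ∀ x → ∃₂ λ (a : Fin k → Bool) (r : Fin m → Bool) → comb a g ⊕ comb r h ≡ x
    independent : ∀ a r → comb a g ⊕ comb r h ≡ zeroVec → (∀ t → a t ≡ false) × (∀ j → r j ≡ false)

  coordinates-unique : ∀ {a r a' r'} → comb a g ⊕ comb r h ≡ comb a' g ⊕ comb r' h →
    (∀ t → a t ≡ a' t) × (∀ j → r j ≡ r' j)
  coordinates-unique {a} {r} {a'} {r'} eq =
    (λ t → Xor.∙≡ε⇒≡ (proj₁ coefficients-zero t)) , (λ j → Xor.∙≡ε⇒≡ (proj₂ coefficients-zero j))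
    where
    open ≡-Reasoning
    difference-zero : comb (λ t → a t xor a' t) g ⊕ comb (λ j → r j xor r' j) h ≡ zeroVec
    difference-zero = begin
      comb (λ t → a t xor a' t) g ⊕ comb (λ j → r j xor r' j) h
        ≡⟨ cong₂ _⊕_ (comb-xor a a' g) (comb-xor r r' h) ⟩
      (comb a g ⊕ comb a' g) ⊕ (comb r h ⊕ comb r' h)  ≡⟨ Z2.∙-interchange _ _ _ _ ⟩
      (comb a g ⊕ comb r h) ⊕ (comb a' g ⊕ comb r' h)  ≡⟨ cong (_⊕ _) eq ⟩
      (comb a' g ⊕ comb r' h) ⊕ (comb a' g ⊕ comb r' h) ≡⟨ ⊕-self _ ⟩
      zeroVec ∎
    coefficients-zero : (∀ t → (a t xor a' t) ≡ false) × (∀ j → (r j xor r' j) ≡ false)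
    coefficients-zero = independent _ _ difference-zero

standardBasis : ∀ {n} (g : Fin 0 → Z2 n) → JointBasis g e
standardBasis g = record
  { decompose = λ x → (λ ()) , lookup x ,
      trans (Z2.identityˡ _) (trans (comb-e (lookup x)) (tabulate∘lookup x))
  ; independent = λ a r eq → (λ ()) , λ j → begin
      r j                     ≡⟨ lookup∘tabulate r j ⟨
      lookup (tabulate r) j   ≡⟨ cong (λ x → lookup x j) (trans (sym (comb-e r)) (trans (sym (Z2.identityˡ _)) eq)) ⟩
      lookup zeroVec j        ≡⟨ lookup-replicate j false ⟩
      false ∎ }
  where open ≡-Reasoning

module Exchange {n k m : ℕ} {g : Fin (suc k) → Z2 n} {h : Fin (suc m) → Z2 n}
  (basis : JointBasis (g ∘ suc) h)
  {a₀ : Fin k → Bool} {r₀ : Fin (suc m) → Bool} (g₀≡ : comb a₀ (g ∘ suc) ⊕ comb r₀ h ≡ g zero)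
  {p : Fin (suc m)} (r₀p : r₀ p ≡ true) where

  open JointBasis basis

  reexpress : ∀ b A Z → comb (b Vector.∷ A) g ⊕ comb Z h ≡
    comb (λ t → A t xor (b ∧ a₀ t)) (g ∘ suc) ⊕ comb (λ j → Z j xor (b ∧ r₀ j)) h
  reexpress b A Z = sym (begin
    comb (λ t → A t xor (b ∧ a₀ t)) (g ∘ suc) ⊕ comb (λ j → Z j xor (b ∧ r₀ j)) h
      ≡⟨ cong₂ _⊕_ (trans (comb-xor A (λ t → b ∧ a₀ t) (g ∘ suc)) (cong (_ ⊕_) (comb-∧ b a₀ (g ∘ suc))))
                   (trans (comb-xor Z (λ j → b ∧ r₀ j) h) (cong (_ ⊕_) (comb-∧ b r₀ h))) ⟩
    (comb A (g ∘ suc) ⊕ b · comb a₀ (g ∘ suc)) ⊕ (comb Z h ⊕ b · comb r₀ h)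
      ≡⟨ Z2.∙-interchange _ _ _ _ ⟩
    (comb A (g ∘ suc) ⊕ comb Z h) ⊕ (b · comb a₀ (g ∘ suc) ⊕ b · comb r₀ h)
      ≡⟨ cong (_ ⊕_) (trans (sym (·-⊕ b _ _)) (cong (b ·_) g₀≡)) ⟩
    (comb A (g ∘ suc) ⊕ comb Z h) ⊕ b · g zero
      ≡⟨ solve 3 (λ u v w → (u ⊞ v) ⊞ w ⊜ (w ⊞ u) ⊞ v) refl _ _ _ ⟩
    (b · g zero ⊕ comb A (g ∘ suc)) ⊕ comb Z h ∎)
    where
    open ≡-Reasoning
    open Z2.Solver using (solve; _⊜_) renaming (_⊕_ to _⊞_)

  exchanged : JointBasis g (Vector.removeAt h p)
  exchanged = record { decompose = decompose′ ; independent = independent′ }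
    where
    decompose′ : ∀ x → ∃₂ λ A R → comb A g ⊕ comb R (Vector.removeAt h p) ≡ x
    decompose′ x with decompose x
    ... | a , y , ax = b Vector.∷ A , Vector.removeAt Z p , (begin
      comb (b Vector.∷ A) g ⊕ comb (Vector.removeAt Z p) (Vector.removeAt h p)
        ≡⟨ cong (comb (b Vector.∷ A) g ⊕_) (comb-removeAt Z h p Zp) ⟨
      comb (b Vector.∷ A) g ⊕ comb Z h
        ≡⟨ reexpress b A Z ⟩
      comb (λ t → A t xor (b ∧ a₀ t)) (g ∘ suc) ⊕ comb (λ j → Z j xor (b ∧ r₀ j)) h
        ≡⟨ cong₂ _⊕_ (comb-cong (g ∘ suc) (λ t → Xor.cancelʳ (b ∧ a₀ t) (a t)))
                     (comb-cong h (λ j → Xor.cancelʳ (b ∧ r₀ j) (y j))) ⟩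
      comb a (g ∘ suc) ⊕ comb y h
        ≡⟨ ax ⟩
      x ∎)
      where
      open ≡-Reasoning
      b = y p
      A = λ t → a t xor (b ∧ a₀ t)
      Z = λ j → y j xor (b ∧ r₀ j)
      Zp : Z p ≡ false
      Zp = trans (cong (λ c → b xor (b ∧ c)) r₀p) (trans (cong (b xor_) (∧-identityʳ b)) (xor-same b))

    independent′ : ∀ A R → comb A g ⊕ comb R (Vector.removeAt h p) ≡ zeroVec →
      (∀ t → A t ≡ false) × (∀ j → R j ≡ false)
    independent′ A R eq = A≡false , λ j → trans (sym (insertAt-punchIn R p false j)) (Z≡false (punchIn p j))
      where
      Z = Vector.insertAt R p false
      old-coordinates-zero : (∀ t → A (suc t) xor (A zero ∧ a₀ t) ≡ false) × (∀ j → Z j xor (A zero ∧ r₀ j) ≡ false)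
      old-coordinates-zero = independent (λ t → A (suc t) xor (A zero ∧ a₀ t)) (λ j → Z j xor (A zero ∧ r₀ j))
        (begin
          _ ≡⟨ reexpress (A zero) (A ∘ suc) Z ⟨
          comb A g ⊕ comb Z h
            ≡⟨ cong (_ ⊕_) (trans (comb-removeAt Z h p (insertAt-lookup R p false))
                                  (comb-cong _ (insertAt-punchIn R p false))) ⟩
          comb A g ⊕ comb R (Vector.removeAt h p) ≡⟨ eq ⟩
          zeroVec ∎)
        where open ≡-Reasoning
      A₀≡false : A zero ≡ false
      A₀≡false = begin
        A zero                         ≡⟨ ∧-identityʳ (A zero) ⟨
        A zero ∧ true                  ≡⟨ cong (A zero ∧_) r₀p ⟨
        false xor (A zero ∧ r₀ p)      ≡⟨ cong (_xor (A zero ∧ r₀ p)) (insertAt-lookup R p false) ⟨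
        Z p xor (A zero ∧ r₀ p)        ≡⟨ proj₂ old-coordinates-zero p ⟩
        false ∎
        where open ≡-Reasoning
      A≡false : ∀ t → A t ≡ false
      A≡false zero    = A₀≡false
      A≡false (suc t) = trans (sym (xor-identityʳ (A (suc t))))
        (trans (cong (λ b → A (suc t) xor (b ∧ a₀ t)) (sym A₀≡false)) (proj₁ old-coordinates-zero t))
      Z≡false : ∀ j → Z j ≡ false
      Z≡false j = trans (sym (xor-identityʳ (Z j)))
        (trans (cong (λ b → Z j xor (b ∧ r₀ j)) (sym A₀≡false)) (proj₂ old-coordinates-zero j))

extendToBasis : ∀ {n k} (g : Fin k → Z2 n) → Independent g →
  Σ ℕ λ m → Σ (Fin m → Z2 n) λ h → k + m ≡ n × JointBasis g h
extendToBasis {n} {zero}  g _ = n , e , refl , standardBasis g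
extendToBasis {n} {suc k} g independent
  with extendToBasis (g ∘ suc) (λ c eq t → independent (false Vector.∷ c) (trans (Z2.identityˡ _) eq) (suc t))
... | m , h , k+m≡n , basis with JointBasis.decompose basis (g zero)
... | a₀ , r₀ , g₀≡ with any? (λ j → r₀ j ≟ᵇ true)
... | yes (p , r₀p) = exchangeAt h k+m≡n basis g₀≡ p r₀p
  where
  exchangeAt : ∀ {m} (h : Fin m → Z2 n) → k + m ≡ n → JointBasis (g ∘ suc) h →
    ∀ {r₀} → comb a₀ (g ∘ suc) ⊕ comb r₀ h ≡ g zero → ∀ p → r₀ p ≡ true →
    Σ ℕ λ m → Σ (Fin m → Z2 n) λ h → suc k + m ≡ n × JointBasis g h
  exchangeAt {suc m} h k+m≡n basis {r₀} g₀≡ p r₀p =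
    m , Vector.removeAt h p , trans (sym (+-suc k m)) k+m≡n , Exchange.exchanged basis {r₀ = r₀} g₀≡ r₀p
... | no none with independent (true Vector.∷ a₀) g-dependent zero
  where
  r₀≡false : ∀ j → r₀ j ≡ false
  r₀≡false j = ¬-not (λ r₀j → none (j , r₀j))
  g-dependent : g zero ⊕ comb a₀ (g ∘ suc) ≡ zeroVec
  g-dependent = begin
    g zero ⊕ comb a₀ (g ∘ suc)                ≡⟨ cong (_⊕ comb a₀ (g ∘ suc)) g₀≡ ⟨
    (comb a₀ (g ∘ suc) ⊕ comb r₀ h) ⊕ comb a₀ (g ∘ suc)
      ≡⟨ cong (λ z → (comb a₀ (g ∘ suc) ⊕ z) ⊕ comb a₀ (g ∘ suc)) (trans (comb-cong h r₀≡false) (comb-false h)) ⟩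
    (comb a₀ (g ∘ suc) ⊕ zeroVec) ⊕ comb a₀ (g ∘ suc)
      ≡⟨ cong (_⊕ comb a₀ (g ∘ suc)) (Z2.identityʳ _) ⟩
    comb a₀ (g ∘ suc) ⊕ comb a₀ (g ∘ suc)     ≡⟨ ⊕-self _ ⟩
    zeroVec ∎
    where open ≡-Reasoning
... | ()

-- The cube I^n_c is the quotient by the zero code; its cycle sums are those of every quotient.
module Cube {n : ℕ} = Quotient {n} {0} (λ ())

coboundary : ∀ {n} → (Z2 n → Bool) → Fin n → Z2 n → Bool
coboundary f i x = f x xor f (x ⊕ e i)

OnEdges : ∀ {n} → (Fin n → Z2 n → Bool) → Set
OnEdges d = ∀ i x → d i (x ⊕ e i) ≡ d i x

module _ {n : ℕ} (f : Z2 n → Bool) where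

  coboundary-onEdges : OnEdges (coboundary f)
  coboundary-onEdges i x =
    trans (cong (f (x ⊕ e i) xor_) (cong f (Z2.cancelʳ (e i) x))) (xor-comm (f (x ⊕ e i)) (f x))

  cycleSum-coboundary : ∀ i j x → Cube.cycleSum (coboundary f) i j x ≡ false
  cycleSum-coboundary i j x rewrite Z2.∙-swapʳ x (e j) (e i) =
    Xor.square-cancel (f x) (f (x ⊕ e i)) (f ((x ⊕ e i) ⊕ e j)) (f (x ⊕ e j))


face : ∀ {n} → (Fin (suc n) → Z2 (suc n) → Bool) → Fin n → Z2 n → Bool
face d j y = d (suc j) (false ∷ y)

-- Integrates d along the path that stays in the facet x₀ = 0 and crosses coordinate 0 last.
potential : ∀ {n} → (Fin n → Z2 n → Bool) → Z2 n → Bool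
potential {zero}  d []      = false
potential {suc n} d (b ∷ y) = potential (face d) y xor (b ∧ d zero (false ∷ y))

potential-zero : ∀ {n} (d : Fin n → Z2 n → Bool) → potential d zeroVec ≡ false
potential-zero {zero}  d = refl
potential-zero {suc n} d = trans (xor-identityʳ _) (potential-zero (face d))

potential-cong : ∀ {n} {d d' : Fin n → Z2 n → Bool} → (∀ i x → d i x ≡ d' i x) →
  ∀ x → potential d x ≡ potential d' x
potential-cong {zero}  d≗d' []      = refl
potential-cong {suc n} d≗d' (b ∷ y) =
  cong₂ _xor_ (potential-cong (λ j w → d≗d' (suc j) (false ∷ w)) y) (cong (b ∧_) (d≗d' zero (false ∷ y)))

face-onEdges : ∀ {n} {d : Fin (suc n) → Z2 (suc n) → Bool} → OnEdges d → OnEdges (face d)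
face-onEdges {d = d} onEdges j y =
  trans (cong (d (suc j)) (sym (∷⊕e-suc false y j))) (onEdges (suc j) (false ∷ y))

face-even : ∀ {n} {d : Fin (suc n) → Z2 (suc n) → Bool} → Cube.Even d → Cube.Even (face d)
face-even {d = d} even j l j≢l y = trans (sym cycleSum-face) (even (suc j) (suc l) (j≢l ∘ suc-injective) (false ∷ y))
  where
  cycleSum-face : Cube.cycleSum d (suc j) (suc l) (false ∷ y) ≡ Cube.cycleSum (face d) j l y
  cycleSum-face rewrite ∷⊕e-suc false y j | ∷⊕e-suc false y l = refl

coboundary-potential : ∀ {n} {d : Fin n → Z2 n → Bool} → OnEdges d → Cube.Even d →
  ∀ i x → coboundary (potential d) i x ≡ d i x
coboundary-potential {suc n} {d} onEdges even zero (b ∷ y) =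
  trans (cong (λ z → potential d (b ∷ y) xor potential d z) (∷⊕e-zero b y)) (crossing b)
  where
  P = potential (face d) y
  D = d zero (false ∷ y)
  crossing : ∀ b → (P xor (b ∧ D)) xor (P xor (not b ∧ D)) ≡ d zero (b ∷ y)
  crossing false = trans (cong (_xor (P xor D)) (xor-identityʳ P)) (Xor.cancelˡ P D)
  crossing true  = begin
    (P xor D) xor (P xor false)  ≡⟨ cong ((P xor D) xor_) (xor-identityʳ P) ⟩
    (P xor D) xor P              ≡⟨ Xor.∙-swapʳ P D P ⟩
    (P xor P) xor D              ≡⟨ cong (_xor D) (xor-same P) ⟩
    D                             ≡⟨ onEdges zero (false ∷ y) ⟨
    d zero ((false ∷ y) ⊕ e zero) ≡⟨ cong (d zero) (∷⊕e-zero false y) ⟩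
    d zero (true ∷ y) ∎
    where open ≡-Reasoning
coboundary-potential {suc n} {d} onEdges even (suc j) (b ∷ y) = begin
  potential d (b ∷ y) xor potential d ((b ∷ y) ⊕ e (suc j))
    ≡⟨ cong (λ z → potential d (b ∷ y) xor potential d z) (∷⊕e-suc b y j) ⟩
  (P y xor (b ∧ D y)) xor (P (y ⊕ e j) xor (b ∧ D (y ⊕ e j)))
    ≡⟨ Xor.∙-interchange (P y) (b ∧ D y) (P (y ⊕ e j)) (b ∧ D (y ⊕ e j)) ⟩
  (P y xor P (y ⊕ e j)) xor ((b ∧ D y) xor (b ∧ D (y ⊕ e j)))
    ≡⟨ cong₂ _xor_ (coboundary-potential (face-onEdges {d = d} onEdges) (face-even {d = d} even) j y)
                   (sym (∧-distribˡ-xor b (D y) (D (y ⊕ e j)))) ⟩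
  d (suc j) (false ∷ y) xor (b ∧ (D y xor D (y ⊕ e j)))
    ≡⟨ across b ⟩
  d (suc j) (b ∷ y) ∎
  where
  open ≡-Reasoning
  P = potential (face d)
  D : Z2 n → Bool
  D w = d zero (false ∷ w)
  square : D y xor (d (suc j) (true ∷ y) xor (D (y ⊕ e j) xor d (suc j) (false ∷ y))) ≡ false
  square = subst (λ z → D y xor (d (suc j) z xor (D (y ⊕ e j) xor d (suc j) (false ∷ y))) ≡ false)
    (∷⊕e-zero false y) (even zero (suc j) (λ ()) (false ∷ y))
  across : ∀ b → d (suc j) (false ∷ y) xor (b ∧ (D y xor D (y ⊕ e j))) ≡ d (suc j) (b ∷ y)
  across false = xor-identityʳ _
  across true  = Xor.∙≡ε⇒≡ (trans
    (solve 4 (λ a t c f → (f ⊞ (a ⊞ c)) ⊞ t ⊜ a ⊞ (t ⊞ (c ⊞ f))) refl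
      (D y) (d (suc j) (true ∷ y)) (D (y ⊕ e j)) (d (suc j) (false ∷ y)))
    square)
    where open Xor.Solver using (solve; _⊜_) renaming (_⊕_ to _⊞_)

locally-constant : ∀ {n} (f : Z2 n → Bool) → (∀ i x → f (x ⊕ e i) ≡ f x) → ∀ x → f x ≡ f zeroVec
locally-constant {zero}  f _        []      = refl
locally-constant {suc n} f locally (b ∷ y) =
  trans (locally-constant (f ∘ (b ∷_)) along-face y) (across b)
  where
  along-face : ∀ j w → f (b ∷ (w ⊕ e j)) ≡ f (b ∷ w)
  along-face j w = trans (cong f (sym (∷⊕e-suc b w j))) (locally (suc j) (b ∷ w))
  across : ∀ b → f (b ∷ zeroVec) ≡ f zeroVec
  across false = refl
  across true  = trans (cong f (sym (∷⊕e-zero false zeroVec))) (locally zero zeroVec)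

coboundary-injective : ∀ {n} (f f' : Z2 n → Bool) →
  (∀ i x → coboundary f i x ≡ coboundary f' i x) → f zeroVec ≡ f' zeroVec → ∀ x → f x ≡ f' x
coboundary-injective f f' δf≗δf' f₀≡f'₀ x = Xor.∙≡ε⇒≡ (begin
  f x xor f' x                    ≡⟨ locally-constant (λ x → f x xor f' x) difference-constant x ⟩
  f zeroVec xor f' zeroVec        ≡⟨ cong (_xor f' zeroVec) f₀≡f'₀ ⟩
  f' zeroVec xor f' zeroVec       ≡⟨ xor-same (f' zeroVec) ⟩
  false ∎)
  where
  open ≡-Reasoning
  difference-constant : ∀ i x → f (x ⊕ e i) xor f' (x ⊕ e i) ≡ f x xor f' x
  difference-constant i x = sym (Xor.∙≡ε⇒≡ (begin
    (f x xor f' x) xor (f (x ⊕ e i) xor f' (x ⊕ e i))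
      ≡⟨ Xor.∙-interchange (f x) (f' x) (f (x ⊕ e i)) (f' (x ⊕ e i)) ⟩
    coboundary f i x xor coboundary f' i x   ≡⟨ cong (_xor coboundary f' i x) (δf≗δf' i x) ⟩
    coboundary f' i x xor coboundary f' i x  ≡⟨ xor-same (coboundary f' i x) ⟩
    false ∎))

module Potentials {n k : ℕ} (g : Fin k → Z2 n) where
  open Quotient g

  Additive : (Z2 n → Bool) → Set
  Additive f = ∀ b x → f (x ⊕ comb b g) ≡ f x xor f (comb b g)

  additivePotentials : Setoid 0ℓ 0ℓ
  additivePotentials = On.setoid {B = Σ (Z2 n → Bool) Additive} (Z2 n →-setoid Bool) proj₁

  ~-translate : ∀ x b → x ~ (x ⊕ comb b g)
  ~-translate x b = b , Z2.cancelˡ x (comb b g)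

  ~-refl : ∀ x → x ~ x
  ~-refl x = (λ _ → false) , trans (⊕-self x) (sym (comb-false g))

  ~⇒translate : ∀ {x y} → x ~ y → ∃ λ b → y ≡ x ⊕ comb b g
  ~⇒translate {x} {y} (b , x⊕y≡) = b , trans (sym (Z2.cancelˡ x y)) (cong (x ⊕_) x⊕y≡)

  additive-zero : ∀ f → Additive f → f zeroVec ≡ false
  additive-zero f additive = begin
    f zeroVec                                  ≡⟨ cong f (trans (cong (zeroVec ⊕_) (comb-false g)) (Z2.identityʳ zeroVec)) ⟨
    f (zeroVec ⊕ comb (λ _ → false) g)         ≡⟨ additive (λ _ → false) zeroVec ⟩
    f zeroVec xor f (comb (λ _ → false) g)     ≡⟨ cong (λ z → f zeroVec xor f z) (comb-false g) ⟩
    f zeroVec xor f zeroVec                    ≡⟨ xor-same (f zeroVec) ⟩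
    false ∎
    where open ≡-Reasoning

  coboundary-translate : ∀ f → Additive f → ∀ b i x → coboundary f i (x ⊕ comb b g) ≡ coboundary f i x
  coboundary-translate f additive b i x = begin
    f (x ⊕ l) xor f ((x ⊕ l) ⊕ e i)          ≡⟨ cong (λ z → f (x ⊕ l) xor f z) (Z2.∙-swapʳ x l (e i)) ⟩
    f (x ⊕ l) xor f ((x ⊕ e i) ⊕ l)          ≡⟨ cong₂ _xor_ (additive b x) (additive b (x ⊕ e i)) ⟩
    (f x xor f l) xor (f (x ⊕ e i) xor f l)  ≡⟨ Xor.cancel-common (f x) (f (x ⊕ e i)) (f l) ⟩
    f x xor f (x ⊕ e i) ∎
    where
    open ≡-Reasoning
    l = comb b g

  coboundary-isDashing : ∀ f → Additive f → IsDashing (coboundary f)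
  coboundary-isDashing f additive i x y (inj₁ (x~y , _)) with ~⇒translate x~y
  ... | b , refl = sym (coboundary-translate f additive b i x)
  coboundary-isDashing f additive i x y (inj₂ (x~y⊕eᵢ , _)) with ~⇒translate x~y⊕eᵢ
  ... | b , y⊕eᵢ≡ = begin
    coboundary f i x                        ≡⟨ coboundary-translate f additive b i x ⟨
    coboundary f i (x ⊕ comb b g)           ≡⟨ cong (coboundary f i) y⊕eᵢ≡ ⟨
    coboundary f i (y ⊕ e i)                ≡⟨ coboundary-onEdges f i y ⟩
    coboundary f i y ∎
    where open ≡-Reasoning

  isDashing-onEdges : ∀ {d} → IsDashing d → OnEdges d
  isDashing-onEdges isDashing i x = sym (isDashing i x (x ⊕ e i)
    (inj₂ (subst (x ~_) (sym (Z2.cancelʳ (e i) x)) (~-refl x) , ~-refl (x ⊕ e i))))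

  isDashing-translate : ∀ {d} → IsDashing d → ∀ b i x → d i (x ⊕ comb b g) ≡ d i x
  isDashing-translate isDashing b i x = sym (isDashing i x (x ⊕ comb b g)
    (inj₁ (~-translate x b , subst ((x ⊕ e i) ~_) (Z2.∙-swapʳ x (e i) (comb b g)) (~-translate (x ⊕ e i) b))))

  potential-additive : ∀ {d} → IsDashing d → Even d → Additive (potential d)
  potential-additive {d} isDashing even b =
    coboundary-injective (λ x → P (x ⊕ l)) (λ x → P x xor P l) same-coboundary
      (trans (cong P (Z2.identityˡ l)) (cong (_xor P l) (sym (potential-zero d))))
    where
    P = potential d
    l = comb b g
    δP≡d : ∀ i x → coboundary P i x ≡ d i x
    δP≡d = coboundary-potential (isDashing-onEdges isDashing) even
    same-coboundary : ∀ i x → P (x ⊕ l) xor P ((x ⊕ e i) ⊕ l) ≡ (P x xor P l) xor (P (x ⊕ e i) xor P l)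
    same-coboundary i x = begin
      P (x ⊕ l) xor P ((x ⊕ e i) ⊕ l)          ≡⟨ cong (λ z → P (x ⊕ l) xor P z) (Z2.∙-swapʳ x (e i) l) ⟩
      coboundary P i (x ⊕ l)                   ≡⟨ δP≡d i (x ⊕ l) ⟩
      d i (x ⊕ l)                              ≡⟨ isDashing-translate isDashing b i x ⟩
      d i x                                    ≡⟨ δP≡d i x ⟨
      P x xor P (x ⊕ e i)                      ≡⟨ Xor.cancel-common (P x) (P (x ⊕ e i)) (P l) ⟨
      (P x xor P l) xor (P (x ⊕ e i) xor P l) ∎
      where open ≡-Reasoning

  additive-comb : ∀ f → Additive f → ∀ {j} (v : Fin j → Z2 n) →
    (∀ c → InL (comb c v)) → ∀ c → f (comb c v) ≡ dot c (f ∘ v)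
  additive-comb f additive {zero}  v inL c = additive-zero f additive
  additive-comb f additive {suc j} v inL c with inL (false Vector.∷ (c ∘ suc))
  ... | b , rest≡ = begin
    f (c zero · v zero ⊕ comb (c ∘ suc) (v ∘ suc))  ≡⟨ cong (λ z → f (c zero · v zero ⊕ z)) rest∈L ⟩
    f (c zero · v zero ⊕ comb b g)                  ≡⟨ additive b (c zero · v zero) ⟩
    f (c zero · v zero) xor f (comb b g)
      ≡⟨ cong₂ _xor_ (scaled (c zero)) (trans (cong f (sym rest∈L)) (additive-comb f additive (v ∘ suc) tail∈L (c ∘ suc))) ⟩
    (c zero ∧ f (v zero)) xor dot (c ∘ suc) (f ∘ v ∘ suc) ∎
    where
    open ≡-Reasoning
    rest∈L : comb (c ∘ suc) (v ∘ suc) ≡ comb b g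
    rest∈L = trans (sym (Z2.identityˡ _)) rest≡
    tail∈L : ∀ c → InL (comb c (v ∘ suc))
    tail∈L c with inL (false Vector.∷ c)
    ... | b , eq = b , trans (sym (Z2.identityˡ _)) eq
    scaled : ∀ b → f (b · v zero) ≡ b ∧ f (v zero)
    scaled true  = refl
    scaled false = additive-zero f additive

  additivePotentials↔evenDashings : Inverse additivePotentials EvenDashings
  additivePotentials↔evenDashings = strictInverse {additivePotentials} {EvenDashings}
    (λ (f , additive) → coboundary f , coboundary-isDashing f additive , λ i j _ → cycleSum-coboundary f i j)
    (λ (d , isDashing , even) → potential d , potential-additive isDashing even)
    (λ f≗f' i x → cong₂ _xor_ (f≗f' x) (f≗f' (x ⊕ e i)))
    (λ d≈d' → potential-cong d≈d')
    (λ (d , isDashing , even) → coboundary-potential (isDashing-onEdges isDashing) even)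
    (λ (f , additive) → coboundary-injective (potential (coboundary f)) f
       (coboundary-potential (coboundary-onEdges f) (λ i j _ → cycleSum-coboundary f i j))
       (trans (potential-zero (coboundary f)) (sym (additive-zero f additive))))

nonzeroPoints : ℕ → ℕ
nonzeroPoints zero    = 0
nonzeroPoints (suc m) = suc (nonzeroPoints m + nonzeroPoints m)

suc-nonzeroPoints : ∀ m → suc (nonzeroPoints m) ≡ 2 ^ m
suc-nonzeroPoints zero    = refl
suc-nonzeroPoints (suc m) = begin
  suc (suc (N + N))      ≡⟨ cong suc (+-suc N N) ⟨
  suc N + suc N          ≡⟨ cong (suc N +_) (+-identityʳ (suc N)) ⟨
  suc N + (suc N + 0)    ≡⟨ cong (λ z → z + (z + 0)) (suc-nonzeroPoints m) ⟩
  2 ^ suc m ∎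
  where
  open ≡-Reasoning
  N = nonzeroPoints m

-- On the facet x₀ = 1 the table records f (1, 0) followed by the table of r ↦ f (1, r) + f (1, 0),
-- which again vanishes at 0.
table : ∀ {m} → (Z2 m → Bool) → Vec Bool (nonzeroPoints m)
table {zero}  f = []
table {suc m} f =
  f (true ∷ zeroVec) ∷ table (f ∘ (false ∷_)) ++ table (λ r → f (true ∷ r) xor f (true ∷ zeroVec))

evaluate : ∀ {m} → Vec Bool (nonzeroPoints m) → Z2 m → Bool
evaluate {zero}  []      []          = false
evaluate {suc m} (c ∷ t) (false ∷ r) = evaluate (take (nonzeroPoints m) t) r
evaluate {suc m} (c ∷ t) (true ∷ r)  = c xor evaluate (drop (nonzeroPoints m) t) r

take-drop-++ : ∀ {A : Set} {a b} (u : Vec A a) (w : Vec A b) → take a (u ++ w) ≡ u × drop a (u ++ w) ≡ w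
take-drop-++ {a = a} u w = ++-injective (take a (u ++ w)) u (take++drop≡id a (u ++ w))

table-cong : ∀ {m} {f f' : Z2 m → Bool} → (∀ r → f r ≡ f' r) → table f ≡ table f'
table-cong {zero}  f≗f' = refl
table-cong {suc m} f≗f' = cong₂ _∷_ (f≗f' (true ∷ zeroVec)) (cong₂ _++_
  (table-cong (f≗f' ∘ (false ∷_)))
  (table-cong (λ r → cong₂ _xor_ (f≗f' (true ∷ r)) (f≗f' (true ∷ zeroVec)))))

evaluate-zero : ∀ {m} (t : Vec Bool (nonzeroPoints m)) → evaluate t zeroVec ≡ false
evaluate-zero {zero}  []      = refl
evaluate-zero {suc m} (c ∷ t) = evaluate-zero (take (nonzeroPoints m) t)

evaluate-table : ∀ {m} (f : Z2 m → Bool) → f zeroVec ≡ false → ∀ r → evaluate (table f) r ≡ f r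
evaluate-table {zero}  f f₀ []          = sym f₀
evaluate-table {suc m} f f₀ (false ∷ r) =
  trans (cong (λ t → evaluate t r) (proj₁ (take-drop-++ (table (f ∘ (false ∷_))) (table f₁))))
        (evaluate-table (f ∘ (false ∷_)) f₀ r)
  where f₁ = λ r → f (true ∷ r) xor f (true ∷ zeroVec)
evaluate-table {suc m} f f₀ (true ∷ r) = begin
  c xor evaluate (drop (nonzeroPoints m) (table (f ∘ (false ∷_)) ++ table f₁)) r
    ≡⟨ cong (λ t → c xor evaluate t r) (proj₂ (take-drop-++ (table (f ∘ (false ∷_))) (table f₁))) ⟩
  c xor evaluate (table f₁) r            ≡⟨ cong (c xor_) (evaluate-table f₁ (xor-same c) r) ⟩
  c xor (f (true ∷ r) xor c)             ≡⟨ cong (c xor_) (xor-comm (f (true ∷ r)) c) ⟩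
  c xor (c xor f (true ∷ r))             ≡⟨ Xor.cancelˡ c (f (true ∷ r)) ⟩
  f (true ∷ r) ∎
  where
  open ≡-Reasoning
  c = f (true ∷ zeroVec)
  f₁ = λ r → f (true ∷ r) xor c

table-evaluate : ∀ {m} (t : Vec Bool (nonzeroPoints m)) → table (evaluate t) ≡ t
table-evaluate {zero}  []      = refl
table-evaluate {suc m} (c ∷ t) = cong₂ _∷_ head-entry (begin
  table (evaluate t₀) ++ table (λ r → (c xor evaluate t₁ r) xor (c xor evaluate t₁ zeroVec))
    ≡⟨ cong₂ _++_ (table-evaluate t₀) (trans (table-cong shifted) (table-evaluate t₁)) ⟩
  t₀ ++ t₁   ≡⟨ take++drop≡id (nonzeroPoints m) t ⟩
  t ∎)
  where
  open ≡-Reasoning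
  t₀ = take (nonzeroPoints m) t
  t₁ = drop (nonzeroPoints m) t
  head-entry : c xor evaluate t₁ zeroVec ≡ c
  head-entry = trans (cong (c xor_) (evaluate-zero t₁)) (xor-identityʳ c)
  shifted : ∀ r → (c xor evaluate t₁ r) xor (c xor evaluate t₁ zeroVec) ≡ evaluate t₁ r
  shifted r = trans (cong ((c xor evaluate t₁ r) xor_) head-entry) (trans (xor-comm (c xor evaluate t₁ r) c) (Xor.cancelˡ c (evaluate t₁ r)))

module Coordinates {n k m : ℕ} {g : Fin k → Z2 n} {h : Fin m → Z2 n} (basis : JointBasis g h) where
  open JointBasis basis
  open Potentials g

  Code : Set
  Code = Vec Bool k × Vec Bool (nonzeroPoints m)

  decode : Code → Z2 n → Bool
  decode (cv , t) x = let (a , r , _) = decompose x in evaluate t (tabulate r) xor dot a (lookup cv)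

  decode-spec : ∀ cv t {a r x} → comb a g ⊕ comb r h ≡ x →
    decode (cv , t) x ≡ evaluate t (tabulate r) xor dot a (lookup cv)
  decode-spec cv t {a} {r} {x} ax with decompose x
  ... | a' , r' , a'x with coordinates-unique (trans a'x (sym ax))
  ... | a'≗a , r'≗r = cong₂ _xor_ (cong (evaluate t) (tabulate-cong r'≗r)) (dot-cong a'≗a (λ _ → refl))

  decode-additive : ∀ code → Additive (decode code)
  decode-additive (cv , t) b x = begin
    decode (cv , t) (x ⊕ comb b g)
      ≡⟨ decode-spec cv t shifted ⟩
    evaluate t (tabulate r) xor dot (λ s → a s xor b s) (lookup cv)
      ≡⟨ cong (evaluate t (tabulate r) xor_) (dot-xorˡ a b (lookup cv)) ⟩
    evaluate t (tabulate r) xor (dot a (lookup cv) xor dot b (lookup cv))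
      ≡⟨ xor-assoc (evaluate t (tabulate r)) (dot a (lookup cv)) (dot b (lookup cv)) ⟨
    (evaluate t (tabulate r) xor dot a (lookup cv)) xor dot b (lookup cv)
      ≡⟨ cong₂ _xor_ (decode-spec cv t ax) on-L ⟨
    decode (cv , t) x xor decode (cv , t) (comb b g) ∎
    where
    open ≡-Reasoning
    a = proj₁ (decompose x)
    r = proj₁ (proj₂ (decompose x))
    ax = proj₂ (proj₂ (decompose x))
    shifted : comb (λ s → a s xor b s) g ⊕ comb r h ≡ x ⊕ comb b g
    shifted = trans (cong (_⊕ comb r h) (comb-xor a b g))
      (trans (Z2.∙-swapʳ (comb a g) (comb b g) (comb r h)) (cong (_⊕ comb b g) ax))
    on-L : decode (cv , t) (comb b g) ≡ dot b (lookup cv)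
    on-L = trans (decode-spec cv t (trans (cong (comb b g ⊕_) (comb-false h)) (Z2.identityʳ _)))
      (cong (_xor dot b (lookup cv)) (trans (cong (evaluate t) tabulate-false) (evaluate-zero t)))

  encode : (Z2 n → Bool) → Code
  encode f = tabulate (f ∘ g) , table (λ ρ → f (comb (lookup ρ) h))

  decode-encode : ∀ f → Additive f → ∀ x → decode (encode f) x ≡ f x
  decode-encode f additive x = begin
    decode (encode f) x
      ≡⟨ decode-spec (tabulate (f ∘ g)) _ ax ⟩
    evaluate (table (λ ρ → f (comb (lookup ρ) h))) (tabulate r) xor dot a (lookup (tabulate (f ∘ g)))
      ≡⟨ cong₂ _xor_ (evaluate-table _ on-zero (tabulate r)) (dot-cong (λ _ → refl) (lookup∘tabulate (f ∘ g))) ⟩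
    f (comb (lookup (tabulate r)) h) xor dot a (f ∘ g)
      ≡⟨ cong₂ _xor_ (cong f (comb-cong h (lookup∘tabulate r))) (sym (additive-comb f additive g (λ c → c , refl) a)) ⟩
    f (comb r h) xor f (comb a g)   ≡⟨ additive a (comb r h) ⟨
    f (comb r h ⊕ comb a g)         ≡⟨ cong f (trans (Z2.comm _ _) ax) ⟩
    f x ∎
    where
    open ≡-Reasoning
    a = proj₁ (decompose x)
    r = proj₁ (proj₂ (decompose x))
    ax = proj₂ (proj₂ (decompose x))
    on-zero : f (comb (lookup zeroVec) h) ≡ false
    on-zero = trans (cong f (trans (comb-cong h (λ j → lookup-replicate j false)) (comb-false h)))
                    (additive-zero f additive)

  encode-decode : ∀ code → encode (decode code) ≡ code
  encode-decode (cv , t) = cong₂ _,_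
    (trans (tabulate-cong on-basis) (tabulate∘lookup cv))
    (trans (table-cong on-complement) (table-evaluate t))
    where
    on-basis : ∀ s → decode (cv , t) (g s) ≡ lookup cv s
    on-basis s = trans
      (decode-spec cv t (trans (cong₂ _⊕_ (comb-unit s g) (comb-false h)) (Z2.identityʳ (g s))))
      (cong₂ _xor_ (trans (cong (evaluate t) tabulate-false) (evaluate-zero t)) (dot-unitˡ s (lookup cv)))
    on-complement : ∀ ρ → decode (cv , t) (comb (lookup ρ) h) ≡ evaluate t ρ
    on-complement ρ = trans
      (decode-spec cv t (trans (cong (_⊕ comb (lookup ρ) h) (comb-false g)) (Z2.identityˡ _)))
      (trans (cong₂ _xor_ (cong (evaluate t) (tabulate∘lookup ρ)) (dot-falseˡ (lookup cv))) (xor-identityʳ _))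

  code↔additivePotentials : Inverse (setoid Code) additivePotentials
  code↔additivePotentials = strictInverse {setoid Code} {additivePotentials}
    (λ code → decode code , decode-additive code)
    (λ (f , _) → encode f)
    (λ { refl x → refl })
    (λ f≗f' → cong₂ _,_ (tabulate-cong (f≗f' ∘ g)) (table-cong (λ ρ → f≗f' (comb (lookup ρ) h))))
    (λ (f , additive) → decode-encode f additive)
    encode-decode

module _ {n k : ℕ} (g : Fin k → Z2 n) where
  open Quotient g

  cycleSum-xor : ∀ d d₀ i j x →
    cycleSum (λ i x → d i x xor d₀ i x) i j x ≡ cycleSum d i j x xor cycleSum d₀ i j x
  cycleSum-xor d d₀ i j x = solve 8
    (λ a a₀ b b₀ c c₀ f f₀ → (a ⊞ a₀) ⊞ ((b ⊞ b₀) ⊞ ((c ⊞ c₀) ⊞ (f ⊞ f₀))) ⊜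
                             (a ⊞ (b ⊞ (c ⊞ f))) ⊞ (a₀ ⊞ (b₀ ⊞ (c₀ ⊞ f₀)))) refl
    (d i x) (d₀ i x) (d j (x ⊕ e i)) (d₀ j (x ⊕ e i)) (d i (x ⊕ e j)) (d₀ i (x ⊕ e j)) (d j x) (d₀ j x)
    where open Xor.Solver using (solve; _⊜_) renaming (_⊕_ to _⊞_)

  evenDashings↔oddDashings : ∀ {d₀} → IsDashing d₀ → Odd d₀ → Inverse EvenDashings OddDashings
  evenDashings↔oddDashings {d₀} d₀-dashing d₀-odd = strictInverse {EvenDashings} {OddDashings}
    (λ (d , dashing , even) → shift d , shift-dashing dashing ,
       λ i j i≢j x → trans (cycleSum-xor d d₀ i j x) (cong₂ _xor_ (even i j i≢j x) (d₀-odd i j i≢j x)))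
    (λ (d , dashing , odd) → shift d , shift-dashing dashing ,
       λ i j i≢j x → trans (cycleSum-xor d d₀ i j x) (cong₂ _xor_ (odd i j i≢j x) (d₀-odd i j i≢j x)))
    (λ d≈d' i x → cong (_xor d₀ i x) (d≈d' i x))
    (λ d≈d' i x → cong (_xor d₀ i x) (d≈d' i x))
    (λ (d , _) i x → Xor.cancelʳ (d₀ i x) (d i x))
    (λ (d , _) i x → Xor.cancelʳ (d₀ i x) (d i x))
    where
    shift : (Fin n → Z2 n → Bool) → Fin n → Z2 n → Bool
    shift d i x = d i x xor d₀ i x
    shift-dashing : ∀ {d} → IsDashing d → IsDashing (shift d)
    shift-dashing dashing i x y same = cong₂ _xor_ (dashing i x y same) (d₀-dashing i x y same)

Fin-2^↔Vec : ∀ l → Fin (2 ^ l) ↔ Vec Bool l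
Fin-2^↔Vec zero    = mk↔ₛ′ (λ _ → []) (λ _ → zero) (λ { [] → refl }) (λ { zero → refl })
Fin-2^↔Vec (suc l) = ↔-trans *↔× (↔-trans (2↔Bool ×-↔ Fin-2^↔Vec l)
  (mk↔ₛ′ (λ (b , v) → b ∷ v) (λ { (b ∷ v) → b , v }) (λ { (b ∷ v) → refl }) (λ { (b , v) → refl })))

Vec-++↔× : ∀ {A : Set} a b → Vec A (a + b) ↔ (Vec A a × Vec A b)
Vec-++↔× a b = mk↔ₛ′ (λ v → take a v , drop a v) (λ (u , w) → u ++ w)
  (λ (u , w) → let (take≡u , drop≡w) = take-drop-++ u w in cong₂ _,_ take≡u drop≡w)
  (take++drop≡id a)

codeCount : ∀ {n k m} → k + m ≡ n →
  Fin (2 ^ (2 ^ (n ∸ k) + k ∸ 1)) ↔ (Vec Bool k × Vec Bool (nonzeroPoints m))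
codeCount {n} {k} {m} k+m≡n = subst (λ l → Fin (2 ^ l) ↔ (Vec Bool k × Vec Bool (nonzeroPoints m)))
  (sym exponent) (↔-trans (Fin-2^↔Vec (k + nonzeroPoints m)) (Vec-++↔× k (nonzeroPoints m)))
  where
  exponent : 2 ^ (n ∸ k) + k ∸ 1 ≡ k + nonzeroPoints m
  exponent = begin
    2 ^ (n ∸ k) + k ∸ 1                ≡⟨ cong (λ z → 2 ^ (z ∸ k) + k ∸ 1) k+m≡n ⟨
    2 ^ (k + m ∸ k) + k ∸ 1            ≡⟨ cong (λ z → 2 ^ z + k ∸ 1) (m+n∸m≡n k m) ⟩
    2 ^ m + k ∸ 1                      ≡⟨ cong (λ z → z + k ∸ 1) (suc-nonzeroPoints m) ⟨
    nonzeroPoints m + k                ≡⟨ +-comm (nonzeroPoints m) k ⟩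
    k + nonzeroPoints m ∎
    where open ≡-Reasoning

mainTheorem1 : (n k : ℕ) (g : Fin k → Z2 n) → Independent g →
    Quotient.Chromotopology g → Quotient.Adinkraizable g →
    Inverse (setoid (Fin (2 ^ (2 ^ (n ∸ k) + k ∸ 1)))) (Quotient.EvenDashings g)
    × Inverse (setoid (Fin (2 ^ (2 ^ (n ∸ k) + k ∸ 1)))) (Quotient.OddDashings g)
mainTheorem1 n k g independent _ ((d₀ , d₀-dashing , d₀-odd) , _) with extendToBasis g independent
... | m , h , k+m≡n , basis = countEven , Composition.inverse countEven (evenDashings↔oddDashings g d₀-dashing d₀-odd)
  where
  countEven : Inverse (setoid (Fin (2 ^ (2 ^ (n ∸ k) + k ∸ 1)))) (Quotient.EvenDashings g)
  countEven = Composition.inverse (codeCount k+m≡n)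
    (Composition.inverse (Coordinates.code↔additivePotentials basis) (Potentials.additivePotentials↔evenDashings g))
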